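{- Let $w$ be a nonempty p-string with $\Pi_w\neq\emptyset$. The number of prefix periods of $w$ is at most $\log_2|w|$.
   Context: Let $\Sigma$ and $\Pi$ be disjoint alphabets; a p-string is a string over $\Sigma\cup\Pi$, indexed from 0, with $w[i:j]=w[i]\cdots w[j-1]$. A permutation $f$ of $\Pi$ acts on p-strings letterwise, fixing letters of $\Sigma$; $x\equiv y$ iff $f(x)=y$ for some permutation $f$ of $\Pi$. For $p\in\mathbb{N}^+$, $p\le|w|$, $p$ is a period of $w$ iff $w[0:|w|-p]\equiv w[p:|w|]$; $\mathrm{period}(w)$ is the smallest period of a nonempty $w$. $\Pi_w$ is the set of parameter characters occurring in $w$. With $k=|\Pi_w|+2$, a positive integer $p$ is a prefix period of $w$ iff there is a prefix $w'$ of $w$ with $\mathrm{period}(w')=p$ and $p\le|w'|/k$. -}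

module Defs where

open import Data.Nat using (ℕ; _+_; _*_; _∸_; _≤_; _<_)
open import Data.List using (List; length; take; drop; map)
open import Data.List.Membership.Propositional using (_∈_)
open import Data.List.Relation.Unary.Unique.Propositional using (Unique)
open import Data.Sum using (_⊎_; inj₁; inj₂)
import Data.Sum as Sum
open import Data.Product using (∃; _×_; _,_)
open import Function using (id; _⇔_)
open import Function.Bundles using (_↔_; Inverse)
open import Relation.Binary.PropositionalEquality using (_≡_)

-- A p-string over constant alphabet S and parameter alphabet P
-- (S and P are disjoint by construction: letters are S ⊎ P).
PString : Set → Set → Set
PString S P = List (S ⊎ P)

module _ {S P : Set} where

  act : P ↔ P → PString S P → PString S P
  act f = map (Sum.map id (Inverse.to f))

  _≈ₚ_ : PString S P → PString S P → Set
  x ≈ₚ y = ∃ λ (f : P ↔ P) → act f x ≡ y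

  IsPeriod : ℕ → PString S P → Set
  IsPeriod p w = (1 ≤ p) × (p ≤ length w) × (take (length w ∸ p) w ≈ₚ drop p w)

  HasSmallestPeriod : PString S P → ℕ → Set
  HasSmallestPeriod w p = 1 ≤ length w × IsPeriod p w × (∀ q → IsPeriod q w → p ≤ q)

  ParamCount : PString S P → ℕ → Set
  ParamCount w m = ∃ λ (l : List P) →
    Unique l × length l ≡ m × (∀ x → (x ∈ l) ⇔ (inj₂ x ∈ w))

  -- p is a prefix period of w: some prefix w' = w[0:n] has period(w') = p
  -- and p ≤ |w'| / k with k = |Π_w| + 2 (i.e. p * k ≤ |w'|)
  PrefixPeriod : PString S P → ℕ → Set
  PrefixPeriod w p = ∃ λ m → ParamCount w m × ∃ λ n → n ≤ length w ×
    HasSmallestPeriod (take n w) p × p * (m + 2) ≤ length (take n w)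

{-# OPTIONS --safe #-}
module Submission where

-- If p < q are prefix periods then 2p ≤ q, so the values ⌊log₂ p⌋ are pairwise
-- distinct and all below ⌊log₂ |w|⌋ (as 2p ≤ |w|). Suppose q < 2p. If the prefix
-- witnessing q is the shorter one, p is a smaller period of it. Otherwise p (via a
-- parameter bijection f) and q (via g) are both periods of the prefix w' witnessing
-- p, and |w'| ≥ (|Π_w| + 2)p. Each column r, r + p, r + 2p, ... of w' carries an
-- f-orbit of length |Π_w| + 1 inside Π_w, and shifting by p and q in either order
-- shows that f and g commute along it; then f⁻¹ ∘ g realises the period q - p < p
-- of w', contradicting the minimality of p.

open import Defs
open import Data.Nat using (ℕ; zero; suc; _+_; _*_; _∸_; _≤_; _<_; z≤n; s≤s; z<s; s<s; _≤?_; _<?_; >-nonZero)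
open import Data.Nat.Properties
open import Data.Nat.DivMod using (_%_; _/_; m≡m%n+[m/n]*n; m%n<n)
open import Data.Nat.GeneralisedArithmetic using (fold; fold-+)
open import Data.Nat.Logarithm using (⌊log₂_⌋; ⌊log₂⌋-mono-≤; ⌊log₂[2*b]⌋≡1+⌊log₂b⌋)
open import Data.Nat.Tactic.RingSolver using (solve-∀)
open import Data.Fin using (Fin; toℕ; fromℕ<) renaming (zero to fzero; suc to fsuc)
import Data.Fin.Properties as Fin
open import Data.List using (List; []; _∷_; length; take; drop; map; lookup)
open import Data.List.Properties using (length-take; length-drop; length-map)
open import Data.List.Membership.Propositional using (_∈_)
open import Data.List.Membership.Propositional.Properties using (∈-length; ∈-lookup)
open import Data.List.Relation.Unary.Any using (here; there; index)
open import Data.List.Relation.Unary.Any.Properties using (lookup-index)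
import Data.List.Relation.Unary.All as All
open import Data.List.Relation.Unary.All using (All)
open import Data.List.Relation.Unary.AllPairs using (_∷_)
open import Data.List.Relation.Unary.Unique.Propositional using (Unique)
open import Data.Maybe using (Maybe; just; nothing)
import Data.Maybe as Maybe
open import Data.Maybe.Properties using (just-injective; map-id; map-∘; map-cong)
open import Data.Sum using (_⊎_; inj₁; inj₂)
import Data.Sum as Sum
open import Data.Sum.Properties using (inj₂-injective)
open import Data.Product using (∃; ∃₂; _×_; _,_; proj₁; proj₂)
open import Data.Empty using (⊥-elim)
open import Function using (_∘_; _⇔_; mk⇔; Injective; case_of_)
open import Function.Bundles using (_↔_; Inverse; Injection; Equivalence)
open import Function.Properties.Inverse using (↔⇒↣)
open import Function.Construct.Composition using (_↔-∘_)
open import Function.Construct.Symmetry using (↔-sym)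
open import Relation.Binary.PropositionalEquality
open import Relation.Binary.Definitions using (tri<; tri≈; tri>)
open import Relation.Nullary using (yes; no)

-- Lacunary sets of naturals

2*m≤n⇒⌊log₂m⌋<⌊log₂n⌋ : ∀ {m n} → 1 ≤ m → 2 * m ≤ n → ⌊log₂ m ⌋ < ⌊log₂ n ⌋
2*m≤n⇒⌊log₂m⌋<⌊log₂n⌋ {m} {n} 1≤m 2m≤n =
  subst (_≤ ⌊log₂ n ⌋) (⌊log₂[2*b]⌋≡1+⌊log₂b⌋ m {{>-nonZero 1≤m}}) (⌊log₂⌋-mono-≤ 2m≤n)

Unique⇒lookup-injective : ∀ {A : Set} {xs : List A} → Unique xs → Injective _≡_ _≡_ (lookup xs)
Unique⇒lookup-injective {xs = _ ∷ _} (x∉xs ∷ _) {fzero} {fzero} _ = refl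
Unique⇒lookup-injective {xs = _ ∷ _} (x∉xs ∷ _) {fzero} {fsuc j} eq = ⊥-elim (All.lookup x∉xs (∈-lookup j) eq)
Unique⇒lookup-injective {xs = _ ∷ _} (x∉xs ∷ _) {fsuc i} {fzero} eq = ⊥-elim (All.lookup x∉xs (∈-lookup i) (sym eq))
Unique⇒lookup-injective {xs = _ ∷ _} (_ ∷ unique) {fsuc i} {fsuc j} eq = cong fsuc (Unique⇒lookup-injective unique eq)

module _ {Q : ℕ → Set} {N : ℕ}
  (positive : ∀ {p} → Q p → 1 ≤ p) (doubled≤ : ∀ {p} → Q p → 2 * p ≤ N)
  (lacunary : ∀ {p q} → Q p → Q q → p < q → 2 * p ≤ q) where

  ⌊log₂⌋-injective : ∀ {p q} → Q p → Q q → ⌊log₂ p ⌋ ≡ ⌊log₂ q ⌋ → p ≡ q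
  ⌊log₂⌋-injective {p} {q} Qp Qq eq with <-cmp p q
  ... | tri< p<q _ _ = ⊥-elim (<-irrefl eq (2*m≤n⇒⌊log₂m⌋<⌊log₂n⌋ (positive Qp) (lacunary Qp Qq p<q)))
  ... | tri≈ _ p≡q _ = p≡q
  ... | tri> _ _ q<p = ⊥-elim (<-irrefl (sym eq) (2*m≤n⇒⌊log₂m⌋<⌊log₂n⌋ (positive Qq) (lacunary Qq Qp q<p)))

  lacunary-length≤⌊log₂⌋ : ∀ {ps} → Unique ps → All Q ps → length ps ≤ ⌊log₂ N ⌋
  lacunary-length≤⌊log₂⌋ {ps} unique Qps = Fin.injective⇒≤ index-injective
    where
    Q-at : ∀ i → Q (lookup ps i)
    Q-at i = All.lookup Qps (∈-lookup i)

    log< : ∀ i → ⌊log₂ lookup ps i ⌋ < ⌊log₂ N ⌋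
    log< i = 2*m≤n⇒⌊log₂m⌋<⌊log₂n⌋ (positive (Q-at i)) (doubled≤ (Q-at i))

    index-injective : Injective _≡_ _≡_ (λ i → fromℕ< (log< i))
    index-injective {i} {j} eq = Unique⇒lookup-injective unique
      (⌊log₂⌋-injective (Q-at i) (Q-at j) (Fin.fromℕ<-injective _ _ (log< i) (log< j) eq))

-- Orbits of an injective map

pigeonhole-∈ : ∀ {A : Set} (l : List A) (h : Fin (suc (length l)) → A) →
  (∀ i → h i ∈ l) → ∃₂ λ i j → toℕ i < toℕ j × h i ≡ h j
pigeonhole-∈ l h h∈l with i , j , i<j , eq ← Fin.pigeonhole (n<1+n _) (index ∘ h∈l) =
  i , j , i<j , trans (lookup-index (h∈l i)) (trans (cong (lookup l) eq) (sym (lookup-index (h∈l j))))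

-- fold x φ t is φᵗ x.
module Orbit {A : Set} (φ : A → A) (φ-injective : Injective _≡_ _≡_ φ) where

  fold-comm : ∀ x a b → fold (fold x φ b) φ a ≡ fold (fold x φ a) φ b
  fold-comm x a b = trans (sym (fold-+ x φ a)) (trans (cong (fold x φ) (+-comm a b)) (fold-+ x φ b))

  fold-injective : ∀ t → Injective _≡_ _≡_ (λ x → fold x φ t)
  fold-injective zero eq = eq
  fold-injective (suc t) eq = fold-injective t (φ-injective eq)

  collision⇒cycle : ∀ x {i j} → i < j → fold x φ i ≡ fold x φ j → fold x φ (j ∸ i) ≡ x
  collision⇒cycle x {i} {j} i<j eq = sym (fold-injective i (begin
    fold x φ i                  ≡⟨ eq ⟩
    fold x φ j                  ≡⟨ cong (fold x φ) (m+[n∸m]≡n (<⇒≤ i<j)) ⟨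
    fold x φ (i + (j ∸ i))      ≡⟨ fold-+ x φ i ⟩
    fold (fold x φ (j ∸ i)) φ i ∎))
    where open ≡-Reasoning

  cycle-reduce : ∀ x {c} → 1 ≤ c → fold x φ c ≡ x → ∀ t → ∃ λ s → s < c × fold x φ t ≡ fold x φ s
  cycle-reduce x 1≤c cycle zero = 0 , 1≤c , refl
  cycle-reduce x {c} 1≤c cycle (suc t) with s , s<c , eq ← cycle-reduce x 1≤c cycle t | suc s <? c
  ... | yes 1+s<c = suc s , 1+s<c , cong φ eq
  ... | no 1+s≮c = 0 , 1≤c , trans (cong φ eq) (trans (cong (fold x φ) (≤-antisym s<c (≮⇒≥ 1+s≮c))) cycle)

  module _ (γ : A → A) where

    Commutes : A → Set
    Commutes y = φ (γ y) ≡ γ (φ y)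

    -- Commutation along the first |l| - 1 steps of an orbit inside l spreads to the
    -- whole orbit: the orbit is a cycle of length at most |l|, and if that length
    -- is exactly |l| then γ x lies on it as well.
    module _ {l : List A} {x : A}
      (orbit∈l : ∀ s → s ≤ length l → fold x φ s ∈ l) (γx∈l : γ x ∈ l)
      (commutes-early : ∀ s → 2 + s ≤ length l → Commutes (fold x φ s)) where

      short-cycle : ∀ {c} → 1 ≤ c → c < length l → fold x φ c ≡ x → ∀ t → Commutes (fold x φ t)
      short-cycle 1≤c c<|l| cycle t with s , s<c , eq ← cycle-reduce x 1≤c cycle t =
        subst Commutes (sym eq) (commutes-early s (≤-trans (s≤s s<c) c<|l|))

      full-cycle : fold x φ (length l) ≡ x → ∀ {k} → γ x ≡ fold x φ k → ∀ t → Commutes (fold x φ t)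
      full-cycle cycle {k} γx≡ t with s , s<|l| , eq ← cycle-reduce x (∈-length (orbit∈l 0 z≤n)) cycle t =
        subst Commutes (sym eq) (commutes s s<|l|)
        where
        γ-fold : ∀ s → s < length l → γ (fold x φ s) ≡ fold (γ x) φ s
        γ-fold zero _ = refl
        γ-fold (suc s) 2+s≤|l| = trans (sym (commutes-early s 2+s≤|l|)) (cong φ (γ-fold s (<-trans (n<1+n s) 2+s≤|l|)))

        commutes : ∀ s → s < length l → Commutes (fold x φ s)
        commutes s s<|l| with 2 + s ≤? length l
        ... | yes 2+s≤|l| = commutes-early s 2+s≤|l|
        ... | no 2+s≰|l| = begin
            φ (γ (fold x φ s))             ≡⟨ cong φ (γ-fold s s<|l|) ⟩
            fold (γ x) φ (suc s)           ≡⟨ cong (fold (γ x) φ) 1+s≡|l| ⟩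
            fold (γ x) φ (length l)        ≡⟨ cong (λ y → fold y φ (length l)) γx≡ ⟩
            fold (fold x φ k) φ (length l) ≡⟨ fold-comm x (length l) k ⟩
            fold (fold x φ (length l)) φ k ≡⟨ cong (λ y → fold y φ k) cycle ⟩
            fold x φ k                     ≡⟨ γx≡ ⟨
            γ x                            ≡⟨ cong γ cycle ⟨
            γ (fold x φ (length l))        ≡⟨ cong (γ ∘ fold x φ) 1+s≡|l| ⟨
            γ (φ (fold x φ s))             ∎
          where
          open ≡-Reasoning
          1+s≡|l| : suc s ≡ length l
          1+s≡|l| = ≤-antisym s<|l| (≮⇒≥ 2+s≰|l|)

      orbit-commutes : ∀ t → Commutes (fold x φ t)
      orbit-commutes
        with i , j , i<j , eq ← pigeonhole-∈ l (fold x φ ∘ toℕ) (λ i → orbit∈l (toℕ i) (Fin.toℕ≤pred[n] i))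
           | suc (toℕ j ∸ toℕ i) ≤? length l
      ... | yes c<|l| = short-cycle (m<n⇒0<n∸m i<j) c<|l| (collision⇒cycle x i<j eq)
      ... | no c≮|l| = second-pigeonhole
        where
        cycle : fold x φ (length l) ≡ x
        cycle = subst (λ c → fold x φ c ≡ x)
          (≤-antisym (≤-trans (m∸n≤m (toℕ j) (toℕ i)) (Fin.toℕ≤pred[n] j)) (≮⇒≥ c≮|l|))
          (collision⇒cycle x i<j eq)

        γx-or-orbit : Fin (suc (length l)) → A
        γx-or-orbit fzero = γ x
        γx-or-orbit (fsuc s) = fold x φ (toℕ s)

        γx-or-orbit∈l : ∀ i → γx-or-orbit i ∈ l
        γx-or-orbit∈l fzero = γx∈l
        γx-or-orbit∈l (fsuc s) = orbit∈l (toℕ s) (<⇒≤ (Fin.toℕ<n s))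

        second-pigeonhole : ∀ t → Commutes (fold x φ t)
        second-pigeonhole with pigeonhole-∈ l γx-or-orbit γx-or-orbit∈l
        ... | fzero , fsuc j′ , _ , eq′ = full-cycle cycle {toℕ j′} eq′
        ... | fsuc i′ , fsuc j′ , s<s i′<j′ , eq′ =
          short-cycle (m<n⇒0<n∸m i′<j′) (≤-<-trans (m∸n≤m (toℕ j′) (toℕ i′)) (Fin.toℕ<n j′))
            (collision⇒cycle x i′<j′ eq′)

-- Lists indexed by natural numbers

map-cong-just : ∀ {A B : Set} {F₁ F₂ : A → B} (mx : Maybe A) →
  (∀ {e} → mx ≡ just e → F₁ e ≡ F₂ e) → Maybe.map F₁ mx ≡ Maybe.map F₂ mx
map-cong-just nothing _ = refl
map-cong-just (just e) F₁≡F₂ = cong just (F₁≡F₂ refl)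

module _ {A : Set} where

  at : List A → ℕ → Maybe A
  at [] _ = nothing
  at (x ∷ xs) zero = just x
  at (x ∷ xs) (suc i) = at xs i

  at-take : ∀ (xs : List A) {n i} → i < n → at (take n xs) i ≡ at xs i
  at-take [] {suc n} _ = refl
  at-take (x ∷ xs) {suc n} {zero} _ = refl
  at-take (x ∷ xs) {suc n} {suc i} (s<s i<n) = at-take xs i<n

  at-drop : ∀ (xs : List A) k i → at (drop k xs) i ≡ at xs (k + i)
  at-drop xs zero i = refl
  at-drop [] (suc k) i = refl
  at-drop (x ∷ xs) (suc k) i = at-drop xs k i

  at-map : ∀ (F : A → A) xs i → at (map F xs) i ≡ Maybe.map F (at xs i)
  at-map F [] i = refl
  at-map F (x ∷ xs) zero = refl
  at-map F (x ∷ xs) (suc i) = at-map F xs i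

  at-∈ : ∀ xs {i v} → at xs i ≡ just v → v ∈ xs
  at-∈ (x ∷ xs) {zero} refl = here refl
  at-∈ (x ∷ xs) {suc i} eq = there (at-∈ xs eq)

  length-take-≤ : ∀ {n} (xs : List A) → n ≤ length xs → length (take n xs) ≡ n
  length-take-≤ {n} xs n≤|xs| = trans (length-take n xs) (m≤n⇒m⊓n≡m n≤|xs|)

  at-ext : ∀ {xs ys : List A} → length xs ≡ length ys →
    (∀ i → i < length xs → at xs i ≡ at ys i) → xs ≡ ys
  at-ext {[]} {[]} _ _ = refl
  at-ext {x ∷ xs} {y ∷ ys} |xs|≡|ys| agree =
    cong₂ _∷_ (just-injective (agree 0 z<s)) (at-ext (suc-injective |xs|≡|ys|) (λ i i< → agree (suc i) (s<s i<)))

  Periodic : (A → A) → ℕ → ℕ → List A → Set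
  Periodic F p n w = ∀ i → i + p < n → at w (i + p) ≡ Maybe.map F (at w i)

  module _ {F : A → A} {p : ℕ} where

    map-take≡drop⇔periodic : ∀ u → map F (take (length u ∸ p) u) ≡ drop p u ⇔ Periodic F p (length u) u
    map-take≡drop⇔periodic u = mk⇔ to from
      where
      shifted : List A
      shifted = map F (take (length u ∸ p) u)

      |shifted| : length shifted ≡ length u ∸ p
      |shifted| = trans (length-map F (take (length u ∸ p) u))
        (length-take-≤ u (m∸n≤m (length u) p))

      at-shifted : ∀ {i} → i < length u ∸ p → at shifted i ≡ Maybe.map F (at u i)
      at-shifted {i} i< = trans (at-map F (take (length u ∸ p) u) i) (cong (Maybe.map F) (at-take u i<))

      at-drop′ : ∀ i → at (drop p u) i ≡ at u (i + p)
      at-drop′ i = trans (at-drop u p i) (cong (at u) (+-comm p i))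

      to : shifted ≡ drop p u → Periodic F p (length u) u
      to eq i i+p< =
        trans (sym (at-drop′ i)) (trans (cong (λ v → at v i) (sym eq)) (at-shifted (m+n≤o⇒m≤o∸n (suc i) i+p<)))

      from : Periodic F p (length u) u → shifted ≡ drop p u
      from periodic = at-ext (trans |shifted| (sym (length-drop p u))) λ i i< →
        let i<|u|∸p = subst (i <_) |shifted| i< in
        trans (at-shifted i<|u|∸p) (trans (sym (periodic i (m<n∸o⇒m+o<n i<|u|∸p))) (sym (at-drop′ i)))
        where
        m<n∸o⇒m+o<n : ∀ {i} → i < length u ∸ p → i + p < length u
        m<n∸o⇒m+o<n {i} i< = m≤o∸n⇒m+n≤o (suc i) (<⇒≤ (m∸n≢0⇒n<m (m<n⇒n≢0 i<))) i<

    periodic-cong : ∀ {n} u v → (∀ i → i < n → at u i ≡ at v i) → Periodic F p n u → Periodic F p n v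
    periodic-cong u v agree periodic i i+p<n =
      trans (sym (agree _ i+p<n)) (trans (periodic i i+p<n) (cong (Maybe.map F) (agree i (≤-<-trans (m≤m+n i p) i+p<n))))

    periodic-≤ : ∀ {n n′} w → n′ ≤ n → Periodic F p n w → Periodic F p n′ w
    periodic-≤ w n′≤n periodic i i+p<n′ = periodic i (<-≤-trans i+p<n′ n′≤n)

    periodic-iterate : ∀ {n} w → Periodic F p n w →
      ∀ r t → r + t * p < n → at w (r + t * p) ≡ Maybe.map (λ e → fold e F t) (at w r)
    periodic-iterate w periodic r zero _ = trans (cong (at w) (+-identityʳ r)) (sym (map-id (at w r)))
    periodic-iterate {n} w periodic r (suc t) r+[p+tp]<n = begin
      at w (r + (p + t * p))                              ≡⟨ cong (at w) r+[p+tp]≡r+tp+p ⟩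
      at w (r + t * p + p)                                ≡⟨ periodic (r + t * p) r+tp+p<n ⟩
      Maybe.map F (at w (r + t * p))                      ≡⟨ cong (Maybe.map F) (periodic-iterate w periodic r t r+tp<n) ⟩
      Maybe.map F (Maybe.map (λ e → fold e F t) (at w r)) ≡⟨ map-∘ {g = F} {f = λ e → fold e F t} (at w r) ⟨
      Maybe.map (λ e → fold e F (suc t)) (at w r)         ∎
      where
      open ≡-Reasoning
      r+[p+tp]≡r+tp+p : r + (p + t * p) ≡ r + t * p + p
      r+[p+tp]≡r+tp+p = trans (cong (r +_) (+-comm p (t * p))) (sym (+-assoc r (t * p) p))
      r+tp+p<n : r + t * p + p < n
      r+tp+p<n = subst (_< n) r+[p+tp]≡r+tp+p r+[p+tp]<n
      r+tp<n : r + t * p < n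
      r+tp<n = ≤-<-trans (+-monoʳ-≤ r (m≤n+m (t * p) p)) r+[p+tp]<n

-- Periods of prefixes of p-strings

fold-map₂ : ∀ {A B : Set} (φ : B → B) (e : A ⊎ B) t →
  fold e (Sum.map₂ φ) t ≡ Sum.map₂ (λ x → fold x φ t) e
fold-map₂ φ (inj₁ a) zero = refl
fold-map₂ φ (inj₁ a) (suc t) = cong (Sum.map₂ φ) (fold-map₂ φ (inj₁ a) t)
fold-map₂ φ (inj₂ b) zero = refl
fold-map₂ φ (inj₂ b) (suc t) = cong (Sum.map₂ φ) (fold-map₂ φ (inj₂ b) t)

module _ {S P : Set} where

  actˡ : P ↔ P → S ⊎ P → S ⊎ P
  actˡ f = Sum.map₂ (Inverse.to f)

  actˡ-sym : ∀ (f : P ↔ P) e → actˡ (↔-sym f) (actˡ f e) ≡ e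
  actˡ-sym f (inj₁ _) = refl
  actˡ-sym f (inj₂ x) = cong inj₂ (Inverse.strictlyInverseʳ f x)

  actˡ-∘ : ∀ (f g : P ↔ P) e → actˡ (f ↔-∘ g) e ≡ actˡ f (actˡ g e)
  actˡ-∘ f g (inj₁ _) = refl
  actˡ-∘ f g (inj₂ _) = refl

  isPeriod-take⇔ : ∀ {p n} (w : PString S P) → n ≤ length w →
    IsPeriod p (take n w) ⇔ (1 ≤ p × p ≤ n × ∃ λ f → Periodic (actˡ f) p n w)
  isPeriod-take⇔ {p} {n} w n≤|w| = mk⇔ to from
    where
    |u|≡n : length (take n w) ≡ n
    |u|≡n = length-take-≤ w n≤|w|

    to : IsPeriod p (take n w) → 1 ≤ p × p ≤ n × ∃ λ f → Periodic (actˡ f) p n w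
    to (1≤p , p≤|u| , f , eq) = 1≤p , subst (p ≤_) |u|≡n p≤|u| , f ,
      periodic-cong (take n w) w (λ _ → at-take w)
        (subst (λ k → Periodic (actˡ f) p k (take n w)) |u|≡n
          (Equivalence.to (map-take≡drop⇔periodic (take n w)) eq))

    from : 1 ≤ p × p ≤ n × (∃ λ f → Periodic (actˡ f) p n w) → IsPeriod p (take n w)
    from (1≤p , p≤n , f , periodic) = 1≤p , subst (p ≤_) (sym |u|≡n) p≤n , f ,
      Equivalence.from (map-take≡drop⇔periodic (take n w))
        (subst (λ k → Periodic (actˡ f) p k (take n w)) (sym |u|≡n)
          (periodic-cong w (take n w) (λ _ i<n → sym (at-take w i<n)) periodic))

-- The length bound forces f and g to commute on the parameters of w[0:n], which is
-- what makes f⁻¹ ∘ g a witness for the period q - p beyond position n - q.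
module ShiftDifference {S P : Set} (w : PString S P) {l : List P}
  (params⊆l : ∀ {x} → inj₂ x ∈ w → x ∈ l) (l≢[] : 1 ≤ length l)
  (f g : P ↔ P) {p q n : ℕ} (p<q : p < q) (q<2p : q < 2 * p)
  (long : p * (length l + 2) ≤ n)
  (periodic-f : Periodic (actˡ f) p n w) (periodic-g : Periodic (actˡ g) q n w) where

  φ γ : P → P
  φ = Inverse.to f
  γ = Inverse.to g

  open Orbit φ (Injection.injective (↔⇒↣ f))

  0<p : 0 < p
  0<p = *-cancelˡ-< 2 0 p (≤-<-trans z≤n q<2p)

  long′ : (2 + length l) * p ≤ n
  long′ = subst (_≤ n) (trans (*-comm p (length l + 2)) (cong (_* p) (+-comm (length l) 2))) long

  3p≤n : 3 * p ≤ n
  3p≤n = ≤-trans (*-monoˡ-≤ p (s≤s (s≤s l≢[]))) long′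

  position< : ∀ {r} k → r < p → k ≤ suc (length l) → r + k * p < n
  position< {r} k r<p k≤ = begin-strict
    r + k * p          <⟨ +-monoˡ-< (k * p) r<p ⟩
    suc k * p          ≤⟨ *-monoˡ-≤ p (s≤s k≤) ⟩
    (2 + length l) * p ≤⟨ long′ ⟩
    n                  ∎
    where open ≤-Reasoning

  -- n - q ≥ 3p - q > p
  beyond-n∸q⇒p≤ : ∀ {i} → n ≤ i + q → p ≤ i
  beyond-n∸q⇒p≤ {i} n≤i+q = <⇒≤ (+-cancelʳ-< (2 * p) p i (begin-strict
    p + 2 * p ≤⟨ 3p≤n ⟩
    n         ≤⟨ n≤i+q ⟩
    i + q     <⟨ +-monoʳ-< i q<2p ⟩
    i + 2 * p ∎))
    where open ≤-Reasoning

  shift : ∀ {F d} → Periodic F d n w → ∀ i {e} → i + d < n → at w i ≡ just e → at w (i + d) ≡ just (F e)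
  shift {F} periodic i i+d<n eq = trans (periodic i i+d<n) (cong (Maybe.map F) eq)

  commutes-early : ∀ {k x} → at w k ≡ just (inj₂ x) → k + p + q < n → Commutes γ x
  commutes-early {k} {x} eq k+p+q<n = inj₂-injective (just-injective (begin
    just (inj₂ (φ (γ x)))  ≡⟨ shift periodic-f (k + q) k+q+p<n (shift periodic-g k k+q<n eq) ⟨
    at w (k + q + p)       ≡⟨ cong (at w) k+q+p≡k+p+q ⟩
    at w (k + p + q)       ≡⟨ shift periodic-g (k + p) k+p+q<n (shift periodic-f k k+p<n eq) ⟩
    just (inj₂ (γ (φ x)))  ∎))
    where
    open ≡-Reasoning
    k+q+p≡k+p+q : k + q + p ≡ k + p + q
    k+q+p≡k+p+q = trans (+-assoc k q p) (trans (cong (k +_) (+-comm q p)) (sym (+-assoc k p q)))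
    k+q+p<n : k + q + p < n
    k+q+p<n = subst (_< n) (sym k+q+p≡k+p+q) k+p+q<n
    k+q<n : k + q < n
    k+q<n = ≤-<-trans (m≤m+n (k + q) p) k+q+p<n
    k+p<n : k + p < n
    k+p<n = ≤-<-trans (m≤m+n (k + p) q) k+p+q<n

  orbit-at : ∀ {r x₀} → at w r ≡ just (inj₂ x₀) → ∀ s → r + s * p < n →
    at w (r + s * p) ≡ just (inj₂ (fold x₀ φ s))
  orbit-at {r} {x₀} eq s r+sp<n =
    trans (periodic-iterate w periodic-f r s r+sp<n)
      (trans (cong (Maybe.map (λ e → fold e (actˡ f) s)) eq) (cong just (fold-map₂ φ (inj₂ x₀) s)))

  -- The column r, r + p, ..., r + |l| p of w[0:n] carries the φ-orbit of x₀,
  -- γ x₀ sits at r + q, and the first |l| - 1 entries are far enough from n for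
  -- commutation to be read off directly.
  commutes-at-residue : ∀ {r x₀} → r < p → at w r ≡ just (inj₂ x₀) → ∀ t → Commutes γ (fold x₀ φ t)
  commutes-at-residue {r} {x₀} r<p eq = orbit-commutes γ orbit∈l γx₀∈l early
    where
    orbit∈l : ∀ s → s ≤ length l → fold x₀ φ s ∈ l
    orbit∈l s s≤|l| = params⊆l (at-∈ w (orbit-at eq s (position< s r<p (m≤n⇒m≤1+n s≤|l|))))

    r+q<n : r + q < n
    r+q<n = <-trans (+-monoʳ-< r q<2p) (position< 2 r<p (s≤s l≢[]))

    γx₀∈l : γ x₀ ∈ l
    γx₀∈l = params⊆l (at-∈ w (shift periodic-g r r+q<n eq))

    early : ∀ s → 2 + s ≤ length l → Commutes γ (fold x₀ φ s)
    early s 2+s≤|l| = commutes-early (orbit-at eq s r+sp<n) r+sp+p+q<n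
      where
      r+sp+p+2p≡r+[3+s]p : ∀ r s p → r + s * p + p + 2 * p ≡ r + (3 + s) * p
      r+sp+p+2p≡r+[3+s]p = solve-∀
      r+sp+p+q<n : r + s * p + p + q < n
      r+sp+p+q<n = begin-strict
        r + s * p + p + q     <⟨ +-monoʳ-< (r + s * p + p) q<2p ⟩
        r + s * p + p + 2 * p ≡⟨ r+sp+p+2p≡r+[3+s]p r s p ⟩
        r + (3 + s) * p       <⟨ position< (3 + s) r<p (s≤s 2+s≤|l|) ⟩
        n                     ∎
        where open ≤-Reasoning
      r+sp<n : r + s * p < n
      r+sp<n = position< s r<p (m≤n⇒m≤1+n (≤-trans (m≤n+m s 2) 2+s≤|l|))

  commutes-at : ∀ {j x} → j < n → at w j ≡ just (inj₂ x) → Commutes γ x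
  commutes-at {j} {x} j<n eq = residue (at w r) refl (trans (sym eq) (trans (cong (at w) j≡r+tp) column))
    where
    instance _ = >-nonZero 0<p
    r t : ℕ
    r = j % p
    t = j / p
    j≡r+tp : j ≡ r + t * p
    j≡r+tp = m≡m%n+[m/n]*n j p
    column : at w (r + t * p) ≡ Maybe.map (λ e → fold e (actˡ f) t) (at w r)
    column = periodic-iterate w periodic-f r t (subst (_< n) j≡r+tp j<n)

    residue : ∀ m → at w r ≡ m → just (inj₂ x) ≡ Maybe.map (λ e → fold e (actˡ f) t) m → Commutes γ x
    residue (just (inj₂ x₀)) eq₀ x≡ = subst (Commutes γ)
      (sym (inj₂-injective (just-injective (trans x≡ (cong just (fold-map₂ φ (inj₂ x₀) t))))))
      (commutes-at-residue (m%n<n j p) eq₀ t)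
    residue (just (inj₁ a)) _ x≡ = case trans x≡ (cong just (fold-map₂ φ (inj₁ a) t)) of λ ()

  f⁻¹∘g : P ↔ P
  f⁻¹∘g = ↔-sym f ↔-∘ g

  difference-before : ∀ i → i + q < n → at w (i + (q ∸ p)) ≡ Maybe.map (actˡ f⁻¹∘g) (at w i)
  difference-before i i+q<n = begin
    at w (i + d)                                     ≡⟨ map-inverse (at w (i + d)) ⟨
    Maybe.map F⁻ (Maybe.map (actˡ f) (at w (i + d))) ≡⟨ cong (Maybe.map F⁻) (periodic-f (i + d) i+d+p<n) ⟨
    Maybe.map F⁻ (at w (i + d + p))                  ≡⟨ cong (Maybe.map F⁻ ∘ at w) i+d+p≡i+q ⟩
    Maybe.map F⁻ (at w (i + q))                      ≡⟨ cong (Maybe.map F⁻) (periodic-g i i+q<n) ⟩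
    Maybe.map F⁻ (Maybe.map (actˡ g) (at w i))       ≡⟨ map-∘ (at w i) ⟨
    Maybe.map (F⁻ ∘ actˡ g) (at w i)                 ≡⟨ map-cong (λ e → sym (actˡ-∘ (↔-sym f) g e)) (at w i) ⟩
    Maybe.map (actˡ f⁻¹∘g) (at w i)                  ∎
    where
    open ≡-Reasoning
    d = q ∸ p
    F⁻ = actˡ (↔-sym f)
    map-inverse : ∀ m → Maybe.map F⁻ (Maybe.map (actˡ f) m) ≡ m
    map-inverse m = trans (sym (map-∘ m)) (trans (map-cong (actˡ-sym f) m) (map-id m))
    i+d+p≡i+q : i + d + p ≡ i + q
    i+d+p≡i+q = trans (+-assoc i d p) (cong (i +_) (trans (+-comm d p) (m+[n∸m]≡n (<⇒≤ p<q))))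
    i+d+p<n : i + d + p < n
    i+d+p<n = subst (_< n) (sym i+d+p≡i+q) i+q<n

  difference-after : ∀ i → i + (q ∸ p) < n → n ≤ i + q → at w (i + (q ∸ p)) ≡ Maybe.map (actˡ f⁻¹∘g) (at w i)
  difference-after i i+d<n n≤i+q = begin
    at w (i + d)                                          ≡⟨ cong (at w) i+d≡j+q ⟩
    at w (j + q)                                          ≡⟨ periodic-g j (subst (_< n) i+d≡j+q i+d<n) ⟩
    Maybe.map (actˡ g) (at w j)                           ≡⟨ map-cong-just (at w j) (λ {e} eq → g≡f⁻¹gf e (λ { refl → commutes-at j<n eq })) ⟩
    Maybe.map (actˡ f⁻¹∘g ∘ actˡ f) (at w j)              ≡⟨ map-∘ (at w j) ⟩
    Maybe.map (actˡ f⁻¹∘g) (Maybe.map (actˡ f) (at w j))  ≡⟨ cong (Maybe.map (actˡ f⁻¹∘g)) (periodic-f j j+p<n) ⟨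
    Maybe.map (actˡ f⁻¹∘g) (at w (j + p))                 ≡⟨ cong (Maybe.map (actˡ f⁻¹∘g) ∘ at w) j+p≡i ⟩
    Maybe.map (actˡ f⁻¹∘g) (at w i)                       ∎
    where
    open ≡-Reasoning
    d = q ∸ p
    j : ℕ
    j = i ∸ p
    j+p≡i : j + p ≡ i
    j+p≡i = m∸n+n≡m (beyond-n∸q⇒p≤ n≤i+q)
    i<n : i < n
    i<n = ≤-<-trans (m≤m+n i d) i+d<n
    j<n : j < n
    j<n = ≤-<-trans (m∸n≤m i p) i<n
    j+p<n : j + p < n
    j+p<n = subst (_< n) (sym j+p≡i) i<n
    i+d≡j+q : i + d ≡ j + q
    i+d≡j+q = trans (cong (_+ d) (sym j+p≡i)) (trans (+-assoc j p d) (cong (j +_) (m+[n∸m]≡n (<⇒≤ p<q))))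
    g≡f⁻¹gf : ∀ e → (∀ {x} → e ≡ inj₂ x → Commutes γ x) → actˡ g e ≡ actˡ f⁻¹∘g (actˡ f e)
    g≡f⁻¹gf (inj₁ _) _ = refl
    g≡f⁻¹gf (inj₂ x) commutes =
      cong inj₂ (trans (sym (Inverse.strictlyInverseʳ f (γ x))) (cong (Inverse.from f) (commutes refl)))

  periodic-difference : Periodic (actˡ f⁻¹∘g) (q ∸ p) n w
  periodic-difference i i+d<n with i + q <? n
  ... | yes i+q<n = difference-before i i+q<n
  ... | no i+q≮n = difference-after i i+d<n (≮⇒≥ i+q≮n)

module _ {S P : Set} (w : PString S P) where

  prefixPeriod-bounds : ∀ {p} → PrefixPeriod w p → 1 ≤ p × 2 * p ≤ length w
  prefixPeriod-bounds {p} (m , _ , n , n≤|w| , (_ , (1≤p , _) , _) , long) = 1≤p , (begin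
    2 * p             ≤⟨ *-monoˡ-≤ p (m≤n+m 2 m) ⟩
    (m + 2) * p       ≡⟨ *-comm (m + 2) p ⟩
    p * (m + 2)       ≤⟨ long ⟩
    length (take n w) ≡⟨ length-take-≤ w n≤|w| ⟩
    n                 ≤⟨ n≤|w| ⟩
    length w          ∎)
    where open ≤-Reasoning

  prefixPeriods-lacunary : (∃ λ x → inj₂ x ∈ w) → ∀ {p q} → PrefixPeriod w p → PrefixPeriod w q → p < q → 2 * p ≤ q
  prefixPeriods-lacunary (x , x∈w) {p} {q}
    (m , (l , _ , |l|≡m , l⇔params) , n , n≤|w| , (_ , p-period , p-minimal) , long)
    (_ , _ , n′ , n′≤|w| , (_ , q-period , q-minimal) , _) p<q
    with 1≤p , p≤n , f , periodic-f ← Equivalence.to (isPeriod-take⇔ w n≤|w|) p-period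
       | _ , q≤n′ , g , periodic-g ← Equivalence.to (isPeriod-take⇔ w n′≤|w|) q-period
       | n′ ≤? n | 2 * p ≤? q
  ... | yes n′≤n | _ = ⊥-elim (<⇒≱ p<q (q-minimal p (Equivalence.from (isPeriod-take⇔ w n′≤|w|)
                          (1≤p , ≤-trans (<⇒≤ p<q) q≤n′ , f , periodic-≤ w n′≤n periodic-f))))
  ... | no _ | yes 2p≤q = 2p≤q
  ... | no n′≰n | no 2p≰q = ⊥-elim (2p≰q (subst (_≤ q) (sym 2p≡p+p)
                              (m≤o∸n⇒m+n≤o p (<⇒≤ p<q) (p-minimal (q ∸ p) difference-period))))
    where
    2p≡p+p : 2 * p ≡ p + p
    2p≡p+p = cong (p +_) (+-identityʳ p)

    params⊆l : ∀ {y} → inj₂ y ∈ w → y ∈ l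
    params⊆l = Equivalence.from (l⇔params _)

    long′ : p * (length l + 2) ≤ n
    long′ = subst₂ (λ k k′ → p * (k + 2) ≤ k′) (sym |l|≡m) (length-take-≤ w n≤|w|) long

    q<2p : q < 2 * p
    q<2p = ≰⇒> 2p≰q

    open ShiftDifference w params⊆l (∈-length (params⊆l x∈w)) f g p<q q<2p long′
      periodic-f (periodic-≤ w (<⇒≤ (≰⇒> n′≰n)) periodic-g)

    difference-period : IsPeriod (q ∸ p) (take n w)
    difference-period = Equivalence.from (isPeriod-take⇔ w n≤|w|)
      (m<n⇒0<n∸m p<q , ≤-trans (m≤n+o⇒m∸n≤o q p (subst (q ≤_) 2p≡p+p (<⇒≤ q<2p))) p≤n , f⁻¹∘g , periodic-difference)

corollary3 : {S P : Set} (w : PString S P) → w ≢ [] → (∃ λ x → inj₂ x ∈ w) →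
    (ps : List ℕ) → Unique ps → All (PrefixPeriod w) ps →
      length ps ≤ ⌊log₂ length w ⌋
corollary3 w _ hasParameter ps unique prefixPeriods =
  lacunary-length≤⌊log₂⌋ (proj₁ ∘ prefixPeriod-bounds w) (proj₂ ∘ prefixPeriod-bounds w)
    (prefixPeriods-lacunary w hasParameter) unique prefixPeriods
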